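{- Let $f\colon 2^{[n]}\to\mathbb{R}$ be a simple supermodular function. If $f$ is not irreducible, then there exist a partition $[n]=S_1\cup S_2$ and simple supermodular functions $g_1\colon 2^{S_1}\to\mathbb{R}$ and $g_2\colon 2^{S_2}\to\mathbb{R}$ such that $f(I)=g_1(I\cap S_1)+g_2(I\cap S_2)$ for all $I\subseteq[n]$.
   Context: For a finite set $S$, a function $f\colon 2^S\to\mathbb{R}$ is supermodular if $f(I\cap J)+f(I\cup J)\ge f(I)+f(J)$ for all $I,J\subseteq S$, and modular if equality always holds. A supermodular $f$ is irreducible if it is not modular and whenever $f=g_1+g_2$ with $g_1,g_2$ supermodular, each $g_i$ differs from $c_if$ by a modular function for some $c_i\ge0$. For $i\in S$, the discrete derivative $\partial_if\colon 2^{S\setminus\{i\}}\to\mathbb{R}$ is $(\partial_if)(I)=f(I\cup\{i\})-f(I)$; it is nondecreasing when $f$ is supermodular. A nondecreasing function $g$ (i.e. $g(I)\ge g(J)$ whenever $I\supseteq J$) is irreducible if it is not constant and whenever $g=h_1+h_2$ with $h_1,h_2$ nondecreasing, each $h_j$ differs by a constant from a nonnegative multiple of $g$. A supermodular $f$ is simple if for each $i\in S$ the function $\partial_if$ is either irreducible (as a nondecreasing function) or constant. -}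

module Defs where

open import Level using (0ℓ)
open import Data.Nat using (ℕ; zero; suc)
open import Data.Bool using (true; false)
open import Data.Fin using (Fin)
open import Data.Fin.Subset using (Subset; _∩_; _∪_; _⊆_; _⊇_)
open import Data.Vec using (insertAt; tabulate; lookup)
open import Data.Product using (Σ; ∃; _×_; _,_)
open import Data.Sum using (_⊎_)
open import Relation.Binary.PropositionalEquality using (_≡_; _≢_)
open import Relation.Binary.Structures using (IsTotalOrder)
open import Algebra.Structures using (IsCommutativeRing)
open import Relation.Nullary using (¬_)

-- An axiomatisation of the real numbers: a Dedekind-complete ordered field.
-- (Any model is isomorphic to ℝ.)
record Reals : Set₁ where
  infixl 6 _+_ _-_
  infixl 7 _*_
  infix 4 _≤_
  field
    Carrier : Set
    _+_ _*_ : Carrier → Carrier → Carrier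
    -_ : Carrier → Carrier
    0# 1# : Carrier
    _≤_ : Carrier → Carrier → Set
    isCommutativeRing : IsCommutativeRing _≡_ _+_ _*_ -_ 0# 1#
    0≢1 : 0# ≢ 1#
    inverse : ∀ x → x ≢ 0# → ∃ λ y → x * y ≡ 1#
    isTotalOrder : IsTotalOrder _≡_ _≤_
    +-mono-≤ : ∀ {x y} z → x ≤ y → x + z ≤ y + z
    *-nonneg : ∀ {x y} → 0# ≤ x → 0# ≤ y → 0# ≤ x * y
    sup : (P : Carrier → Set) → (∃ λ x → P x) →
          (∃ λ b → ∀ x → P x → x ≤ b) →
          ∃ λ s → (∀ x → P x → x ≤ s) × (∀ b → (∀ x → P x → x ≤ b) → s ≤ b)

  _-_ : Carrier → Carrier → Carrier
  x - y = x + (- y)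

module _ (R : Reals) where
  open Reals R

  SetFn : ℕ → Set
  SetFn n = Subset n → Carrier

  Supermodular : ∀ {n} → SetFn n → Set
  Supermodular f = ∀ I J → f I + f J ≤ f (I ∩ J) + f (I ∪ J)

  Modular : ∀ {n} → SetFn n → Set
  Modular f = ∀ I J → f (I ∩ J) + f (I ∪ J) ≡ f I + f J

  ModularMultiple : ∀ {n} → SetFn n → SetFn n → Set
  ModularMultiple g f = ∃ λ c → 0# ≤ c × Modular (λ I → g I - c * f I)

  IrreducibleSupermodular : ∀ {n} → SetFn n → Set
  IrreducibleSupermodular f =
    ¬ Modular f ×
    (∀ g₁ g₂ → Supermodular g₁ → Supermodular g₂ → (∀ I → f I ≡ g₁ I + g₂ I) →
      ModularMultiple g₁ f × ModularMultiple g₂ f)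

  Nondecreasing : ∀ {n} → SetFn n → Set
  Nondecreasing g = ∀ I J → I ⊇ J → g J ≤ g I

  Constant : ∀ {n} → SetFn n → Set
  Constant g = ∀ I J → g I ≡ g J

  ConstMultiple : ∀ {n} → SetFn n → SetFn n → Set
  ConstMultiple h g = ∃ λ c → 0# ≤ c × ∃ λ d → ∀ I → h I ≡ c * g I + d

  IrreducibleNondecreasing : ∀ {n} → SetFn n → Set
  IrreducibleNondecreasing g =
    ¬ Constant g ×
    (∀ h₁ h₂ → Nondecreasing h₁ → Nondecreasing h₂ → (∀ I → g I ≡ h₁ I + h₂ I) →
      ConstMultiple h₁ g × ConstMultiple h₂ g)

  -- discrete derivative ∂_i f : 2^([n+1] ∖ {i}) → ℝ ; [n+1] ∖ {i} is identified
  -- with Fin n via punchIn i (insertAt places the i-th coordinate).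
  ∂ : ∀ {n} → Fin (suc n) → SetFn (suc n) → SetFn n
  ∂ i f I = f (insertAt I i true) - f (insertAt I i false)

  Simple : ∀ {n} → SetFn n → Set
  Simple {zero} f = Supermodular f
  Simple {suc n} f = Supermodular f ×
    (∀ i → IrreducibleNondecreasing (∂ i f) ⊎ Constant (∂ i f))

-- restriction I ↦ I ∩ S along an embedding e : Fin m → Fin n enumerating S
restrict : ∀ {m n} → (Fin m → Fin n) → Subset n → Subset m
restrict e I = tabulate (λ j → lookup I (e j))

{-# OPTIONS --safe #-}
module Submission where

open import Defs
open import Data.Nat using (ℕ; _≤_)
open import Data.Fin using (Fin)
open import Data.Fin.Subset using (Subset)
open import Data.Product using (Σ; ∃; _×_; _,_)
open import Data.Sum using (_⊎_)
open import Relation.Binary.PropositionalEquality using (_≡_; _≢_)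
open import Relation.Nullary using (¬_)
open import Function.Definitions using (Injective)

open import Level using (0ℓ)
open import Function using (_∘_; id)
open import Data.Bool using (Bool; true; false; _∧_; _∨_)
open import Data.Maybe using (Maybe; nothing; just)
import Data.Nat as ℕ
import Data.Nat.Properties as ℕ
open import Data.Nat using (zero; suc; s≤s; z≤n)
open import Data.Product using (proj₁; proj₂)
import Data.Product as Product
open import Data.Sum using (inj₁; inj₂)
import Data.Sum as Sum
open import Data.Fin using () renaming (zero to fzero; suc to fsuc)
open import Data.Fin.Properties using (_≟_; suc-injective; any?; all?; ¬∀⟶∃¬)
open import Data.Fin.Subset using (_∩_; _∪_; _⊆_; _⊃_; _∈_; _∉_; ∁; ∣_∣; ⊥; ⊤; ⁅_⁆)
open import Data.Fin.Subset.Properties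
  using (_∈?_; drop-∷-⊆; drop-there; out⊆; in⊆in; s⊆s; ⊆-min; ⊆-max; ∩-idem; ∪-idem; ∩-assoc; ∩-inverseˡ; ∩-zeroˡ;
         x∈p⇒x∉∁p; x∉p⇒x∈∁p; x∉∁p⇒x∈p; x∈∁p⇒x∉p; p⊆p∪q; x∈p∪q⁻; x∈p∪q⁺; x∈⁅x⁆; x∈⁅y⁆⇒x≡y; anySubset?)
open import Data.Fin.Subset.Induction using (⊃-wellFounded)
open import Data.Vec using (Vec; []; _∷_; lookup; insertAt; removeAt; _[_]≔_; zipWith; here; there)
open import Data.Vec.Properties
  using ([]=⇒lookup; lookup⇒[]=; insertAt-removeAt; removeAt-insertAt; lookup∘tabulate; []≔-idempotent; []≔-commutes)
open import Induction.WellFounded using (Acc; acc)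
open import Relation.Binary.PropositionalEquality
open import Relation.Binary.Structures using (IsTotalOrder)
open import Relation.Binary.Bundles using (TotalOrder)
open import Relation.Nullary using (Dec; yes; no; contradiction)
open import Relation.Nullary.Decidable using (¬?; _×-dec_; map′; decidable-stable)
open import Algebra.Bundles using (CommutativeRing; RawRing)
open import Algebra.Solver.Ring.AlmostCommutativeRing using (fromCommutativeRing; _-Raw-AlmostCommutative⟶_)

-- Call coordinates i and j interacting when the mixed difference Δⱼ Δᵢ f is somewhere nonzero.
-- An irreducible nondecreasing function takes only its least and greatest values, since truncating
-- it at an intermediate value would split it; so for simple f the values of ∂ᵢ f can be compared
-- and interaction is decidable.  If every coordinate is connected to 0 in the interaction graph,
-- then in a supermodular splitting f = g₁ + g₂ each ∂ᵢ g₁ is cᵢ ∂ᵢ f plus a constant and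
-- interaction forces cᵢ = cⱼ, so g₁ - c f has constant derivatives and is modular: f is
-- irreducible.  Otherwise the component S of 0 is proper and no interaction crosses its boundary,
-- which gives f(I) = f(I ∩ S) + f(I ∖ S) - f(∅); the derivatives of both pieces are derivatives
-- of f, so the pieces are simple.

zipWith-insertAt : ∀ {A B C : Set} {n} (f : A → B → C) (xs : Vec A n) (ys : Vec B n) i x y →
                   zipWith f (insertAt xs i x) (insertAt ys i y) ≡ insertAt (zipWith f xs ys) i (f x y)
zipWith-insertAt f xs ys fzero x y = refl
zipWith-insertAt f (x′ ∷ xs) (y′ ∷ ys) (fsuc i) x y = cong (f x′ y′ ∷_) (zipWith-insertAt f xs ys i x y)

zipWith-[]≔ : ∀ {A B C : Set} {n} (f : A → B → C) (xs : Vec A n) (ys : Vec B n) i x y →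
              zipWith f (xs [ i ]≔ x) (ys [ i ]≔ y) ≡ zipWith f xs ys [ i ]≔ f x y
zipWith-[]≔ f (x′ ∷ xs) (y′ ∷ ys) fzero x y = refl
zipWith-[]≔ f (x′ ∷ xs) (y′ ∷ ys) (fsuc i) x y = cong (f x′ y′ ∷_) (zipWith-[]≔ f xs ys i x y)

insertAt-[]≔ : ∀ {A : Set} {n} (xs : Vec A n) i (x y : A) → insertAt xs i x [ i ]≔ y ≡ insertAt xs i y
insertAt-[]≔ xs fzero x y = refl
insertAt-[]≔ (x′ ∷ xs) (fsuc i) x y = cong (x′ ∷_) (insertAt-[]≔ xs i x y)

[]≔-insertAt-removeAt : ∀ {A : Set} {n} (xs : Vec A (suc n)) i (y : A) → xs [ i ]≔ y ≡ insertAt (removeAt xs i) i y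
[]≔-insertAt-removeAt xs i y = begin
  xs [ i ]≔ y                                     ≡⟨ cong (_[ i ]≔ y) (insertAt-removeAt xs i) ⟨
  insertAt (removeAt xs i) i (lookup xs i) [ i ]≔ y ≡⟨ insertAt-[]≔ (removeAt xs i) i (lookup xs i) y ⟩
  insertAt (removeAt xs i) i y                    ∎
  where open ≡-Reasoning

p⊆q⇒p∩q≡p : ∀ {n} {p q : Subset n} → p ⊆ q → p ∩ q ≡ p
p⊆q⇒p∩q≡p {p = []} {[]} _ = refl
p⊆q⇒p∩q≡p {p = false ∷ p} {y ∷ q} h = cong (false ∷_) (p⊆q⇒p∩q≡p (drop-∷-⊆ h))
p⊆q⇒p∩q≡p {p = true ∷ p} {y ∷ q} h with h here
... | here = cong (true ∷_) (p⊆q⇒p∩q≡p (drop-∷-⊆ h))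

p⊆q⇒p∪q≡q : ∀ {n} {p q : Subset n} → p ⊆ q → p ∪ q ≡ q
p⊆q⇒p∪q≡q {p = []} {[]} _ = refl
p⊆q⇒p∪q≡q {p = false ∷ p} {y ∷ q} h = cong (y ∷_) (p⊆q⇒p∪q≡q (drop-∷-⊆ h))
p⊆q⇒p∪q≡q {p = true ∷ p} {y ∷ q} h with h here
... | here = cong (true ∷_) (p⊆q⇒p∪q≡q (drop-∷-⊆ h))

∷-⊆ : ∀ {m n x y} {p q : Subset m} {p′ q′ : Subset n} → x ∷ p ⊆ y ∷ q → p′ ⊆ q′ → x ∷ p′ ⊆ y ∷ q′
∷-⊆ {x = false} _ p′⊆q′ = out⊆ p′⊆q′
∷-⊆ {x = true} h p′⊆q′ with h here
... | here = in⊆in p′⊆q′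

insertAt-mono : ∀ {n} {p q : Subset n} i b → p ⊆ q → insertAt p i b ⊆ insertAt q i b
insertAt-mono fzero b p⊆q = s⊆s p⊆q
insertAt-mono {p = x ∷ p} {y ∷ q} (fsuc i) b p⊆q = ∷-⊆ p⊆q (insertAt-mono i b (drop-∷-⊆ p⊆q))

removeAt-mono : ∀ {n} {p q : Subset (suc n)} i → p ⊆ q → removeAt p i ⊆ removeAt q i
removeAt-mono {p = x ∷ p} {y ∷ q} fzero p⊆q = drop-∷-⊆ p⊆q
removeAt-mono {p = x ∷ x′ ∷ p} {y ∷ y′ ∷ q} (fsuc i) p⊆q = ∷-⊆ p⊆q (removeAt-mono i (drop-∷-⊆ p⊆q))

lookup-restrict : ∀ {m n} (e : Fin m → Fin n) p a → lookup (restrict e p) a ≡ lookup p (e a)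
lookup-restrict e p = lookup∘tabulate (λ a → lookup p (e a))

restrict-mono : ∀ {m n} (e : Fin m → Fin n) {p q} → p ⊆ q → restrict e p ⊆ restrict e q
restrict-mono e {p} {q} p⊆q {a} a∈ = lookup⇒[]= a (restrict e q) (begin
  lookup (restrict e q) a ≡⟨ lookup-restrict e q a ⟩
  lookup q (e a)          ≡⟨ []=⇒lookup (p⊆q (lookup⇒[]= (e a) p (trans (sym (lookup-restrict e p a)) ([]=⇒lookup a∈)))) ⟩
  true                    ∎)
  where open ≡-Reasoning

∩-agrees : ∀ {n} (S L : Subset n) k → k ∉ S ⊎ lookup (S ∩ L) k ≡ lookup L k
∩-agrees (true ∷ S) (x ∷ L) fzero = inj₂ refl
∩-agrees (false ∷ S) (x ∷ L) fzero = inj₁ (λ ())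
∩-agrees (s ∷ S) (x ∷ L) (fsuc k) with ∩-agrees S L k
... | inj₁ k∉S = inj₁ (k∉S ∘ drop-there)
... | inj₂ agree = inj₂ agree

∩-[]≔ : ∀ {n} {S : Subset n} {j} → j ∈ S → ∀ L b → S ∩ (L [ j ]≔ b) ≡ (S ∩ L) [ j ]≔ b
∩-[]≔ here (x ∷ L) b = refl
∩-[]≔ {S = s ∷ S} (there j∈S) (x ∷ L) b = cong ((s ∧ x) ∷_) (∩-[]≔ j∈S L b)

embed : ∀ {n} (S : Subset n) → Fin ∣ S ∣ → Fin n
embed (true ∷ S) fzero = fzero
embed (true ∷ S) (fsuc a) = fsuc (embed S a)
embed (false ∷ S) a = fsuc (embed S a)

embed-∈ : ∀ {n} (S : Subset n) a → embed S a ∈ S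
embed-∈ (true ∷ S) fzero = here
embed-∈ (true ∷ S) (fsuc a) = there (embed-∈ S a)
embed-∈ (false ∷ S) a = there (embed-∈ S a)

embed-injective : ∀ {n} (S : Subset n) → Injective _≡_ _≡_ (embed S)
embed-injective (true ∷ S) {fzero} {fzero} _ = refl
embed-injective (true ∷ S) {fsuc a} {fsuc b} eq = cong fsuc (embed-injective S (suc-injective eq))
embed-injective (false ∷ S) eq = embed-injective S (suc-injective eq)

∈⇒embed : ∀ {n} {S : Subset n} {k} → k ∈ S → ∃ λ a → embed S a ≡ k
∈⇒embed {S = true ∷ S} here = fzero , refl
∈⇒embed {S = true ∷ S} (there k∈S) with ∈⇒embed k∈S
... | a , refl = fsuc a , refl
∈⇒embed {S = false ∷ S} (there k∈S) with ∈⇒embed k∈S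
... | a , refl = a , refl

embed-disjoint : ∀ {n} (S : Subset n) a b → embed S a ≢ embed (∁ S) b
embed-disjoint S a b eq = x∈∁p⇒x∉p (embed-∈ (∁ S) b) (subst (_∈ S) eq (embed-∈ S a))

embed-cover : ∀ {n} (S : Subset n) k → (∃ λ a → embed S a ≡ k) ⊎ (∃ λ b → embed (∁ S) b ≡ k)
embed-cover S k with k ∈? S
... | yes k∈S = inj₁ (∈⇒embed k∈S)
... | no k∉S = inj₂ (∈⇒embed (x∉p⇒x∈∁p k∉S))

widen : ∀ {n} (S : Subset n) → Subset ∣ S ∣ → Subset n
widen [] [] = []
widen (true ∷ S) (x ∷ J) = x ∷ widen S J
widen (false ∷ S) J = false ∷ widen S J

restrict-widen : ∀ {n} (S : Subset n) J → restrict (embed S) (widen S J) ≡ J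
restrict-widen [] [] = refl
restrict-widen (true ∷ S) (x ∷ J) = cong (x ∷_) (restrict-widen S J)
restrict-widen (false ∷ S) J = restrict-widen S J

widen-restrict : ∀ {n} (S : Subset n) I → widen S (restrict (embed S) I) ≡ S ∩ I
widen-restrict [] [] = refl
widen-restrict (true ∷ S) (x ∷ I) = cong (x ∷_) (widen-restrict S I)
widen-restrict (false ∷ S) (x ∷ I) = cong (false ∷_) (widen-restrict S I)

widen-∩ : ∀ {n} (S : Subset n) J K → widen S (J ∩ K) ≡ widen S J ∩ widen S K
widen-∩ [] [] [] = refl
widen-∩ (true ∷ S) (x ∷ J) (y ∷ K) = cong ((x ∧ y) ∷_) (widen-∩ S J K)
widen-∩ (false ∷ S) J K = cong (false ∷_) (widen-∩ S J K)

widen-∪ : ∀ {n} (S : Subset n) J K → widen S (J ∪ K) ≡ widen S J ∪ widen S K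
widen-∪ [] [] [] = refl
widen-∪ (true ∷ S) (x ∷ J) (y ∷ K) = cong ((x ∨ y) ∷_) (widen-∪ S J K)
widen-∪ (false ∷ S) J K = cong (false ∷_) (widen-∪ S J K)

widen-[]≔ : ∀ {n} (S : Subset n) J a b → widen S (J [ a ]≔ b) ≡ widen S J [ embed S a ]≔ b
widen-[]≔ (true ∷ S) (x ∷ J) fzero b = refl
widen-[]≔ (true ∷ S) (x ∷ J) (fsuc a) b = cong (x ∷_) (widen-[]≔ S J a b)
widen-[]≔ (false ∷ S) J a b = cong (false ∷_) (widen-[]≔ S J a b)

-- Simple g unfolds only when the dimension of g is a successor or zero, which ∣ S ∣ is not;
-- so f ∘ widen S is handled through this interface, over an abstract dimension m.
record Coordinates {n} (S : Subset n) (m : ℕ) : Set where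
  field
    embedding : Fin m → Fin n
    extend : Subset m → Subset n
    embedding-∈ : ∀ a → embedding a ∈ S
    restrict-extend : ∀ J → restrict embedding (extend J) ≡ J
    extend-restrict : ∀ I → extend (restrict embedding I) ≡ S ∩ I
    extend-∩ : ∀ J K → extend (J ∩ K) ≡ extend J ∩ extend K
    extend-∪ : ∀ J K → extend (J ∪ K) ≡ extend J ∪ extend K
    extend-[]≔ : ∀ J a b → extend (J [ a ]≔ b) ≡ extend J [ embedding a ]≔ b

coordinates : ∀ {n} (S : Subset n) → Coordinates S ∣ S ∣
coordinates S = record
  { embedding = embed S
  ; extend = widen S
  ; embedding-∈ = embed-∈ S
  ; restrict-extend = restrict-widen S
  ; extend-restrict = widen-restrict S
  ; extend-∩ = widen-∩ S
  ; extend-∪ = widen-∪ S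
  ; extend-[]≔ = widen-[]≔ S
  }

-- Reachability in a graph on Fin n

data Reachable {n} (E : Fin n → Fin n → Set) (S : Subset n) : Fin n → Set where
  source : ∀ {i} → i ∈ S → Reachable E S i
  step : ∀ {i j} → Reachable E S i → E i j → Reachable E S j

Closed : ∀ {n} → (Fin n → Fin n → Set) → Subset n → Set
Closed E T = ∀ {i j} → i ∈ T → E i j → j ∈ T

reachable-closed : ∀ {n} {E : Fin n → Fin n → Set} {S T} → Closed E T → S ⊆ T → ∀ {i} → Reachable E S i → i ∈ T
reachable-closed T-closed S⊆T (source i∈S) = S⊆T i∈S
reachable-closed T-closed S⊆T (step reach e) = T-closed (reachable-closed T-closed S⊆T reach) e

reachable-or-cut : ∀ {n} {E : Fin n → Fin n → Set} → (∀ i j → Dec (E i j)) → ∀ S →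
                   (∀ i → Reachable E S i) ⊎ (∃ λ T → S ⊆ T × (∃ λ j → j ∉ T) × Closed E T)
reachable-or-cut {n} {E} E? S = grow S (⊃-wellFounded S) (λ i∈S → i∈S) source
  where
  Leaving : Subset n → Set
  Leaving T = ∃ λ i → ∃ λ j → (i ∈ T × j ∉ T) × E i j
  leaving? : ∀ T → Dec (Leaving T)
  leaving? T = any? (λ i → any? (λ j → ((i ∈? T) ×-dec (¬? (j ∈? T))) ×-dec E? i j))
  grow : ∀ T → Acc _⊃_ T → S ⊆ T → (∀ {i} → i ∈ T → Reachable E S i) →
         (∀ i → Reachable E S i) ⊎ (∃ λ T → S ⊆ T × (∃ λ j → j ∉ T) × Closed E T)
  grow T (acc smaller) S⊆T T-reachable with leaving? T
  ... | yes (i , j , (i∈T , j∉T) , e) =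
    grow (T ∪ ⁅ j ⁆) (smaller T⊂T∪j) (p⊆p∪q ⁅ j ⁆ ∘ S⊆T) (λ {k} k∈ → extended k (x∈p∪q⁻ T ⁅ j ⁆ k∈))
    where
    T⊂T∪j : (T ∪ ⁅ j ⁆) ⊃ T
    T⊂T∪j = p⊆p∪q ⁅ j ⁆ , j , x∈p∪q⁺ (inj₂ (x∈⁅x⁆ j)) , j∉T
    extended : ∀ k → k ∈ T ⊎ k ∈ ⁅ j ⁆ → Reachable E S k
    extended k (inj₁ k∈T) = T-reachable k∈T
    extended k (inj₂ k∈⁅j⁆) = subst (Reachable E S) (sym (x∈⁅y⁆⇒x≡y j k∈⁅j⁆)) (step (T-reachable i∈T) e)
  ... | no not-leaving with all? (_∈? T)
  ...   | yes all∈T = inj₁ (λ i → T-reachable (all∈T i))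
  ...   | no ¬all∈T = inj₂ (T , S⊆T , ¬∀⟶∃¬ n (_∈ T) (_∈? T) ¬all∈T , T-closed)
    where
    T-closed : Closed E T
    T-closed {i} {j} i∈T e with j ∈? T
    ... | yes j∈T = j∈T
    ... | no j∉T = contradiction (i , j , (i∈T , j∉T) , e) not-leaving

reachable-from-isolated : ∀ {n} {E : Fin n → Fin n → Set} {i} → (∀ j → ¬ E i j) → ∀ {k} → Reachable E ⁅ i ⁆ k → k ≡ i
reachable-from-isolated {E = E} {i} isolated reach =
  x∈⁅y⁆⇒x≡y i (reachable-closed ⁅i⁆-closed (λ k∈ → k∈) reach)
  where
  ⁅i⁆-closed : Closed E ⁅ i ⁆
  ⁅i⁆-closed {k} {j} k∈⁅i⁆ e with x∈⁅y⁆⇒x≡y i k∈⁅i⁆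
  ... | refl = contradiction e (isolated j)

module RealsRingSolver (R : Reals) where
  open Reals R

  commutativeRing : CommutativeRing 0ℓ 0ℓ
  commutativeRing = record { isCommutativeRing = isCommutativeRing }

  open CommutativeRing commutativeRing
    using (+-assoc; +-comm; +-identityˡ; +-identityʳ; -‿inverseʳ; distribˡ; distribʳ; ring; +-group;
           +-abelianGroup; +-commutativeSemigroup; +-monoid; semiring)
  open import Algebra.Properties.Group +-group using (⁻¹-involutive; ε⁻¹≈ε)
  open import Algebra.Properties.AbelianGroup +-abelianGroup using (⁻¹-∙-comm; ⁻¹-anti-homo‿-)
  open import Algebra.Properties.CommutativeSemigroup +-commutativeSemigroup using (interchange)
  open import Algebra.Properties.Ring ring using (-‿distribˡ-*; -‿distribʳ-*)
  open import Algebra.Definitions.RawMonoid (CommutativeRing.+-rawMonoid commutativeRing) renaming (_×_ to _·_)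
  open import Algebra.Properties.Monoid.Mult +-monoid using (×-homo-+)
  open import Algebra.Properties.Semiring.Mult semiring using (×1-homo-*)
  open ≡-Reasoning

  -+-interchange : ∀ a b c d → (a + c) - (b + d) ≡ (a - b) + (c - d)
  -+-interchange a b c d = begin
    (a + c) + - (b + d)   ≡⟨ cong ((a + c) +_) (⁻¹-∙-comm b d) ⟨
    (a + c) + (- b + - d) ≡⟨ interchange a c (- b) (- d) ⟩
    (a - b) + (c - d)     ∎

  -*-expand : ∀ a b c d → (a - b) * (c - d) ≡ (a * c + b * d) - (a * d + b * c)
  -*-expand a b c d = begin
    (a - b) * (c - d)                           ≡⟨ distribʳ (c - d) a (- b) ⟩
    a * (c - d) + - b * (c - d)                 ≡⟨ cong₂ _+_ (distribˡ a c (- d)) (distribˡ (- b) c (- d)) ⟩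
    (a * c + a * - d) + (- b * c + - b * - d)   ≡⟨ cong₂ (λ u v → (a * c + u) + (v + - b * - d))
                                                     (sym (-‿distribʳ-* a d)) (sym (-‿distribˡ-* b c)) ⟩
    (a * c - a * d) + (- (b * c) + - b * - d)   ≡⟨ cong (λ z → (a * c - a * d) + (- (b * c) + z)) neg*neg ⟩
    (a * c - a * d) + (- (b * c) + b * d)       ≡⟨ cong ((a * c - a * d) +_) (+-comm (- (b * c)) (b * d)) ⟩
    (a * c - a * d) + (b * d - b * c)           ≡⟨ interchange (a * c) (- (a * d)) (b * d) (- (b * c)) ⟩
    (a * c + b * d) + (- (a * d) + - (b * c))   ≡⟨ cong ((a * c + b * d) +_) (⁻¹-∙-comm (a * d) (b * c)) ⟩
    (a * c + b * d) - (a * d + b * c)           ∎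
    where
    neg*neg : - b * - d ≡ b * d
    neg*neg = begin
      - b * - d     ≡⟨ -‿distribˡ-* b (- d) ⟨
      - (b * - d)   ≡⟨ cong -_ (-‿distribʳ-* b d) ⟨
      - (- (b * d)) ≡⟨ ⁻¹-involutive (b * d) ⟩
      b * d         ∎

  +-cross⇒-≡ : ∀ a b c d → a + d ≡ b + c → a - b ≡ c - d
  +-cross⇒-≡ a b c d e = begin
    a - b             ≡⟨ +-identityʳ (a - b) ⟨
    (a - b) + 0#      ≡⟨ cong ((a - b) +_) (-‿inverseʳ d) ⟨
    (a - b) + (d - d) ≡⟨ -+-interchange a b d d ⟨
    (a + d) - (b + d) ≡⟨ cong (_- (b + d)) e ⟩
    (b + c) - (b + d) ≡⟨ -+-interchange b b c d ⟩
    (b - b) + (c - d) ≡⟨ cong (_+ (c - d)) (-‿inverseʳ b) ⟩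
    0# + (c - d)      ≡⟨ +-identityˡ (c - d) ⟩
    c - d             ∎

  -- Coefficients: a pair (a , b) of naturals stands for the difference a − b.  Pairs are kept
  -- reduced (one component zero), so closed coefficient arithmetic computes to a normal form.
  reduce : ℕ × ℕ → ℕ × ℕ
  reduce (suc a , suc b) = reduce (a , b)
  reduce (zero , b) = (zero , b)
  reduce (suc a , zero) = (suc a , zero)

  differences : RawRing 0ℓ 0ℓ
  differences = record
    { Carrier = ℕ × ℕ
    ; _≈_ = _≡_
    ; _+_ = λ { (a , b) (c , d) → reduce (a ℕ.+ c , b ℕ.+ d) }
    ; _*_ = λ { (a , b) (c , d) → reduce (a ℕ.* c ℕ.+ b ℕ.* d , a ℕ.* d ℕ.+ b ℕ.* c) }
    ; -_ = λ { (a , b) → (b , a) }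
    ; 0# = (0 , 0)
    ; 1# = (1 , 0)
    }

  difference : ℕ × ℕ → Carrier
  difference (a , b) = a · 1# - b · 1#

  -- Agrees with difference, but sends (0 , 0) and (1 , 0) to 0# and 1# on the nose,
  -- as the solver requires.
  ⟦_⟧ : ℕ × ℕ → Carrier
  ⟦ zero , zero ⟧ = 0#
  ⟦ suc zero , zero ⟧ = 1#
  ⟦ p ⟧ = difference p

  ⟦⟧≡difference : ∀ p → ⟦ p ⟧ ≡ difference p
  ⟦⟧≡difference (zero , zero) = sym (-‿inverseʳ 0#)
  ⟦⟧≡difference (suc zero , zero) = sym (begin
    (1# + 0#) - 0# ≡⟨ cong ((1# + 0#) +_) ε⁻¹≈ε ⟩
    (1# + 0#) + 0# ≡⟨ +-identityʳ (1# + 0#) ⟩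
    1# + 0#        ≡⟨ +-identityʳ 1# ⟩
    1#             ∎)
  ⟦⟧≡difference (zero , suc b) = refl
  ⟦⟧≡difference (suc zero , suc b) = refl
  ⟦⟧≡difference (suc (suc a) , b) = refl

  reduce-sound : ∀ p → difference (reduce p) ≡ difference p
  reduce-sound (suc a , suc b) = begin
    difference (reduce (a , b))  ≡⟨ reduce-sound (a , b) ⟩
    a · 1# - b · 1#              ≡⟨ +-cross⇒-≡ (1# + a · 1#) (1# + b · 1#) (a · 1#) (b · 1#) swap ⟨
    suc a · 1# - suc b · 1#      ∎
    where
    swap : (1# + a · 1#) + b · 1# ≡ (1# + b · 1#) + a · 1#
    swap = trans (+-assoc 1# _ _) (trans (cong (1# +_) (+-comm (a · 1#) (b · 1#))) (sym (+-assoc 1# _ _)))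
  reduce-sound (zero , b) = refl
  reduce-sound (suc a , zero) = refl

  ⟦reduce⟧ : ∀ p → ⟦ reduce p ⟧ ≡ difference p
  ⟦reduce⟧ p = trans (⟦⟧≡difference (reduce p)) (reduce-sound p)

  differences⟶reals : differences -Raw-AlmostCommutative⟶ fromCommutativeRing commutativeRing
  differences⟶reals = record
    { ⟦_⟧ = ⟦_⟧
    ; +-homo = λ { (a , b) (c , d) → begin
        ⟦ reduce (a ℕ.+ c , b ℕ.+ d) ⟧          ≡⟨ ⟦reduce⟧ (a ℕ.+ c , b ℕ.+ d) ⟩
        (a ℕ.+ c) · 1# - (b ℕ.+ d) · 1#         ≡⟨ cong₂ _-_ (×-homo-+ 1# a c) (×-homo-+ 1# b d) ⟩
        (a · 1# + c · 1#) - (b · 1# + d · 1#)   ≡⟨ -+-interchange (a · 1#) (b · 1#) (c · 1#) (d · 1#) ⟩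
        difference (a , b) + difference (c , d) ≡⟨ cong₂ _+_ (⟦⟧≡difference (a , b)) (⟦⟧≡difference (c , d)) ⟨
        ⟦ a , b ⟧ + ⟦ c , d ⟧                   ∎ }
    ; *-homo = λ { (a , b) (c , d) → begin
        ⟦ reduce (a ℕ.* c ℕ.+ b ℕ.* d , a ℕ.* d ℕ.+ b ℕ.* c) ⟧
          ≡⟨ ⟦reduce⟧ (a ℕ.* c ℕ.+ b ℕ.* d , a ℕ.* d ℕ.+ b ℕ.* c) ⟩
        (a ℕ.* c ℕ.+ b ℕ.* d) · 1# - (a ℕ.* d ℕ.+ b ℕ.* c) · 1#
          ≡⟨ cong₂ _-_ (product-sum a c b d) (product-sum a d b c) ⟩
        (a · 1# * c · 1# + b · 1# * d · 1#) - (a · 1# * d · 1# + b · 1# * c · 1#)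
          ≡⟨ -*-expand (a · 1#) (b · 1#) (c · 1#) (d · 1#) ⟨
        difference (a , b) * difference (c , d)
          ≡⟨ cong₂ _*_ (⟦⟧≡difference (a , b)) (⟦⟧≡difference (c , d)) ⟨
        ⟦ a , b ⟧ * ⟦ c , d ⟧ ∎ }
    ; -‿homo = λ { (a , b) → begin
        ⟦ b , a ⟧           ≡⟨ ⟦⟧≡difference (b , a) ⟩
        b · 1# - a · 1#     ≡⟨ ⁻¹-anti-homo‿- (a · 1#) (b · 1#) ⟨
        - difference (a , b) ≡⟨ cong -_ (⟦⟧≡difference (a , b)) ⟨
        - ⟦ a , b ⟧         ∎ }
    ; 0-homo = refl
    ; 1-homo = refl
    }
    where
    product-sum : ∀ a c b d → (a ℕ.* c ℕ.+ b ℕ.* d) · 1# ≡ a · 1# * c · 1# + b · 1# * d · 1#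
    product-sum a c b d = trans (×-homo-+ 1# (a ℕ.* c) (b ℕ.* d)) (cong₂ _+_ (×1-homo-* a c) (×1-homo-* b d))

  differences-≟ : ∀ p q → Maybe (⟦ p ⟧ ≡ ⟦ q ⟧)
  differences-≟ (a , b) (c , d) with a ℕ.+ d ℕ.≟ b ℕ.+ c
  ... | no _ = nothing
  ... | yes e = just (begin
    ⟦ a , b ⟧          ≡⟨ ⟦⟧≡difference (a , b) ⟩
    a · 1# - b · 1#    ≡⟨ +-cross⇒-≡ (a · 1#) (b · 1#) (c · 1#) (d · 1#) cross ⟩
    c · 1# - d · 1#    ≡⟨ ⟦⟧≡difference (c , d) ⟨
    ⟦ c , d ⟧          ∎)
    where
    cross : a · 1# + d · 1# ≡ b · 1# + c · 1#
    cross = trans (sym (×-homo-+ 1# a d)) (trans (cong (_· 1#) e) (×-homo-+ 1# b c))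

  open import Algebra.Solver.Ring differences (fromCommutativeRing commutativeRing) differences⟶reals differences-≟
    public using (solve; _:=_; _:+_; _:*_; _:-_; :-_; con)

module _ (R : Reals) where
  open Reals R renaming (_≤_ to _≤ℝ_)
  open RealsRingSolver R
  open CommutativeRing commutativeRing using (+-comm; +-identityʳ; +-group; +-commutativeSemigroup)
  open import Algebra.Properties.CommutativeSemigroup +-commutativeSemigroup using (interchange)
  open import Algebra.Properties.Group +-group using (x∙y⁻¹≈ε⇒x≈y; x≈y⇒x∙y⁻¹≈ε)
  open IsTotalOrder isTotalOrder using (total; antisym) renaming (refl to ≤ℝ-refl; trans to ≤ℝ-trans)

  totalOrder : TotalOrder 0ℓ 0ℓ 0ℓ
  totalOrder = record { isTotalOrder = isTotalOrder }

  open import Algebra.Construct.NaturalChoice.Min totalOrder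
    using (_⊓_; x≤y⇒x⊓y≈x; x≤y⇒y⊓x≈x; ⊓-monoˡ-≤)
  open ≡-Reasoning

  x-y≡0⇒x≡y : ∀ {x y} → x - y ≡ 0# → x ≡ y
  x-y≡0⇒x≡y = x∙y⁻¹≈ε⇒x≈y _ _

  x-x≡0 : ∀ x → x - x ≡ 0#
  x-x≡0 x = x≈y⇒x∙y⁻¹≈ε refl

  x-y≡z⇒x≡y+z : ∀ {x y z} → x - y ≡ z → x ≡ y + z
  x-y≡z⇒x≡y+z {x} {y} {z} x-y≡z = begin
    x             ≡⟨ solve 2 (λ x y → x := y :+ (x :- y)) refl x y ⟩
    y + (x - y)   ≡⟨ cong (y +_) x-y≡z ⟩
    y + z         ∎

  +≤+⇒-≤- : ∀ {a b x y} → a + b ≤ℝ x + y → a - x ≤ℝ y - b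
  +≤+⇒-≤- {a} {b} {x} {y} ab≤xy = subst₂ _≤ℝ_
    (solve 4 (λ a b x y → (a :+ b) :+ (:- x :+ :- b) := a :- x) refl a b x y)
    (solve 4 (λ a b x y → (x :+ y) :+ (:- x :+ :- b) := y :- b) refl a b x y)
    (+-mono-≤ (- x + - b) ab≤xy)

  a-b≡c-d⇒a≡c+[b-d] : ∀ {a b c d} → a - b ≡ c - d → a ≡ c + (b - d)
  a-b≡c-d⇒a≡c+[b-d] {a} {b} {c} {d} a-b≡c-d = begin
    a                 ≡⟨ solve 2 (λ a b → a := (a :- b) :+ b) refl a b ⟩
    (a - b) + b       ≡⟨ cong (_+ b) a-b≡c-d ⟩
    (c - d) + b       ≡⟨ solve 3 (λ b c d → (c :- d) :+ b := c :+ (b :- d)) refl b c d ⟩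
    c + (b - d)       ∎

  0≤1 : 0# ≤ℝ 1#
  0≤1 with total 0# 1#
  ... | inj₁ 0≤1 = 0≤1
  ... | inj₂ 1≤0 = subst (0# ≤ℝ_) (solve 0 ((:- con (1 , 0)) :* (:- con (1 , 0)) := con (1 , 0)) refl) (*-nonneg 0≤-1 0≤-1)
    where
    0≤-1 : 0# ≤ℝ - 1#
    0≤-1 = subst₂ _≤ℝ_ (x-x≡0 1#) (solve 0 (con (0 , 0) :- con (1 , 0) := :- con (1 , 0)) refl) (+-mono-≤ (- 1#) 1≤0)

  ¬1≤0 : ¬ 1# ≤ℝ 0#
  ¬1≤0 1≤0 = 0≢1 (antisym 0≤1 1≤0)

  x≤y⇒0≤y-x : ∀ {x y} → x ≤ℝ y → 0# ≤ℝ y - x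
  x≤y⇒0≤y-x {x} {y} x≤y = subst (_≤ℝ y - x) (x-x≡0 x) (+-mono-≤ (- x) x≤y)

  x≤y⇒x-y≤0 : ∀ {x y} → x ≤ℝ y → x - y ≤ℝ 0#
  x≤y⇒x-y≤0 {x} {y} x≤y = subst (x - y ≤ℝ_) (x-x≡0 y) (+-mono-≤ (- y) x≤y)

  nonzero-*-cancel : ∀ x y → x ≢ 0# → x * y ≡ 0# → y ≡ 0#
  nonzero-*-cancel x y x≢0 xy≡0 with inverse x x≢0
  ... | x⁻¹ , xx⁻¹≡1 = begin
    y               ≡⟨ solve 1 (λ y → y := y :* con (1 , 0)) refl y ⟩
    y * 1#          ≡⟨ cong (y *_) xx⁻¹≡1 ⟨
    y * (x * x⁻¹)   ≡⟨ solve 3 (λ x y z → y :* (x :* z) := z :* (x :* y)) refl x y x⁻¹ ⟩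
    x⁻¹ * (x * y)   ≡⟨ cong (x⁻¹ *_) xy≡0 ⟩
    x⁻¹ * 0#        ≡⟨ solve 1 (λ z → z :* con (0 , 0) := con (0 , 0)) refl x⁻¹ ⟩
    0#              ∎

  x≤t⇒x-x⊓t≡0 : ∀ {x t} → x ≤ℝ t → x - x ⊓ t ≡ 0#
  x≤t⇒x-x⊓t≡0 {x} x≤t = trans (cong (λ m → x - m) (x≤y⇒x⊓y≈x x≤t)) (x-x≡0 x)

  t≤x⇒x-x⊓t≡x-t : ∀ {x t} → t ≤ℝ x → x - x ⊓ t ≡ x - t
  t≤x⇒x-x⊓t≡x-t {x} t≤x = cong (λ m → x - m) (x≤y⇒y⊓x≈x t≤x)

  excess-mono : ∀ t {x y} → x ≤ℝ y → x - x ⊓ t ≤ℝ y - y ⊓ t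
  excess-mono t {x} {y} x≤y = by-cases (total x t) (total y t)
    where
    by-cases : x ≤ℝ t ⊎ t ≤ℝ x → y ≤ℝ t ⊎ t ≤ℝ y → x - x ⊓ t ≤ℝ y - y ⊓ t
    by-cases (inj₁ x≤t) (inj₁ y≤t) = subst₂ _≤ℝ_ (sym (x≤t⇒x-x⊓t≡0 x≤t)) (sym (x≤t⇒x-x⊓t≡0 y≤t)) ≤ℝ-refl
    by-cases (inj₁ x≤t) (inj₂ t≤y) = subst₂ _≤ℝ_ (sym (x≤t⇒x-x⊓t≡0 x≤t)) (sym (t≤x⇒x-x⊓t≡x-t t≤y)) (x≤y⇒0≤y-x t≤y)
    by-cases (inj₂ t≤x) (inj₁ y≤t) = subst₂ _≤ℝ_ (sym (t≤x⇒x-x⊓t≡x-t t≤x)) (sym (x≤t⇒x-x⊓t≡0 y≤t)) (x≤y⇒x-y≤0 (≤ℝ-trans x≤y y≤t))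
    by-cases (inj₂ t≤x) (inj₂ t≤y) = subst₂ _≤ℝ_ (sym (t≤x⇒x-x⊓t≡x-t t≤x)) (sym (t≤x⇒x-x⊓t≡x-t t≤y)) (+-mono-≤ (- t) x≤y)

  -- One of c and 1 - c is nonzero; the total order decides which.
  affine-fixes⇒≡⊎≡ : ∀ {c d α β t} → α ≡ c * α + d → t ≡ c * t + d → t ≡ c * β + d → t ≡ α ⊎ t ≡ β
  affine-fixes⇒≡⊎≡ {c} {d} {α} {β} {t} fixα fixt β↦t with total c (1# - c)
  ... | inj₁ c≤1-c = inj₁ (x-y≡0⇒x≡y (nonzero-*-cancel (1# - c) (t - α) 1-c≢0 (begin
        (1# - c) * (t - α)                    ≡⟨ solve 4 (λ c d α t → (con (1 , 0) :- c) :* (t :- α)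
                                                    := (t :- (c :* t :+ d)) :- (α :- (c :* α :+ d))) refl c d α t ⟩
        (t - (c * t + d)) - (α - (c * α + d)) ≡⟨ cong₂ _-_ (x≈y⇒x∙y⁻¹≈ε fixt) (x≈y⇒x∙y⁻¹≈ε fixα) ⟩
        0# - 0#                               ≡⟨ x-x≡0 0# ⟩
        0#                                    ∎)))
    where
    1-c≢0 : 1# - c ≢ 0#
    1-c≢0 1-c≡0 = ¬1≤0 (subst₂ _≤ℝ_ (sym (x-y≡0⇒x≡y 1-c≡0)) 1-c≡0 c≤1-c)
  ... | inj₂ 1-c≤c = inj₂ (sym (x-y≡0⇒x≡y (nonzero-*-cancel c (β - t) c≢0 (begin
        c * (β - t)               ≡⟨ solve 4 (λ c d β t → c :* (β :- t) := (c :* β :+ d) :- (c :* t :+ d)) refl c d β t ⟩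
        (c * β + d) - (c * t + d) ≡⟨ cong₂ _-_ (sym β↦t) (sym fixt) ⟩
        t - t                     ≡⟨ x-x≡0 t ⟩
        0#                        ∎))))
    where
    c≢0 : c ≢ 0#
    c≢0 c≡0 = ¬1≤0 (subst₂ _≤ℝ_ (trans (cong (λ z → 1# - z) c≡0) (solve 0 (con (1 , 0) :- con (0 , 0) := con (1 , 0)) refl)) c≡0 1-c≤c)

  -- Truncating g at t = g K splits it into two nondecreasing parts, so the truncation is affine in g.
  irreducible⇒two-valued : ∀ {m} {g : SetFn R m} → Nondecreasing R g → IrreducibleNondecreasing R g →
                           ∀ K → g K ≡ g ⊥ ⊎ g K ≡ g ⊤
  irreducible⇒two-valued {m} {g} g↑ (_ , split) K =
    from-multiple (proj₁ (split below-t above-t below-t↑ above-t↑ g≡below+above))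
    where
    t : Carrier
    t = g K
    below-t above-t : SetFn R m
    below-t I = g I ⊓ t
    above-t I = g I - g I ⊓ t
    below-t↑ : Nondecreasing R below-t
    below-t↑ I J I⊇J = ⊓-monoˡ-≤ t (g↑ I J I⊇J)
    above-t↑ : Nondecreasing R above-t
    above-t↑ I J I⊇J = excess-mono t (g↑ I J I⊇J)
    g≡below+above : ∀ I → g I ≡ below-t I + above-t I
    g≡below+above I = solve 2 (λ x m → x := m :+ (x :- m)) refl (g I) (g I ⊓ t)
    from-multiple : ConstMultiple R below-t g → t ≡ g ⊥ ⊎ t ≡ g ⊤
    from-multiple (c , _ , d , below≡) = affine-fixes⇒≡⊎≡
      (trans (sym (x≤y⇒x⊓y≈x (g↑ K ⊥ (⊆-min K)))) (below≡ ⊥))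
      (trans (sym (x≤y⇒x⊓y≈x ≤ℝ-refl)) (below≡ K))
      (trans (sym (x≤y⇒y⊓x≈x (g↑ ⊤ K (⊆-max K)))) (below≡ ⊤))

  irreducible⇒⊥≢⊤ : ∀ {m} {g : SetFn R m} → Nondecreasing R g → IrreducibleNondecreasing R g → g ⊥ ≢ g ⊤
  irreducible⇒⊥≢⊤ {g = g} g↑ (non-constant , _) g⊥≡g⊤ = non-constant (λ I J → trans (≡g⊥ I) (sym (≡g⊥ J)))
    where
    ≡g⊥ : ∀ I → g I ≡ g ⊥
    ≡g⊥ I = antisym (subst (g I ≤ℝ_) (sym g⊥≡g⊤) (g↑ ⊤ I (⊆-max I))) (g↑ I ⊥ (⊆-min I))

  irreducible⇒≡-dec : ∀ {m} {g : SetFn R m} → Nondecreasing R g → IrreducibleNondecreasing R g →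
                      ∀ I J → Dec (g I ≡ g J)
  irreducible⇒≡-dec {g = g} g↑ g-irr I J = compare (irreducible⇒two-valued g↑ g-irr I) (irreducible⇒two-valued g↑ g-irr J)
    where
    ⊥≢⊤ : g ⊥ ≢ g ⊤
    ⊥≢⊤ = irreducible⇒⊥≢⊤ g↑ g-irr
    compare : g I ≡ g ⊥ ⊎ g I ≡ g ⊤ → g J ≡ g ⊥ ⊎ g J ≡ g ⊤ → Dec (g I ≡ g J)
    compare (inj₁ I≡⊥) (inj₁ J≡⊥) = yes (trans I≡⊥ (sym J≡⊥))
    compare (inj₂ I≡⊤) (inj₂ J≡⊤) = yes (trans I≡⊤ (sym J≡⊤))
    compare (inj₁ I≡⊥) (inj₂ J≡⊤) = no (λ I≡J → ⊥≢⊤ (trans (sym I≡⊥) (trans I≡J J≡⊤)))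
    compare (inj₂ I≡⊤) (inj₁ J≡⊥) = no (λ I≡J → ⊥≢⊤ (trans (sym J≡⊥) (trans (sym I≡J) I≡⊤)))

  -- Discrete derivatives

  -- ∂ i g without removing coordinate i, so that derivatives in different directions compose.
  Δ : ∀ {n} → Fin n → SetFn R n → SetFn R n
  Δ i g L = g (L [ i ]≔ true) - g (L [ i ]≔ false)

  Δ-[]≔ : ∀ {n} i (g : SetFn R n) L b → Δ i g (L [ i ]≔ b) ≡ Δ i g L
  Δ-[]≔ i g L b = cong₂ (λ L₁ L₀ → g L₁ - g L₀) ([]≔-idempotent L i) ([]≔-idempotent L i)

  ∂≡Δ-insertAt : ∀ {n} i (g : SetFn R (suc n)) K b → ∂ R i g K ≡ Δ i g (insertAt K i b)
  ∂≡Δ-insertAt i g K b = sym (cong₂ (λ L₁ L₀ → g L₁ - g L₀) (insertAt-[]≔ K i b true) (insertAt-[]≔ K i b false))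

  Δ≡∂-removeAt : ∀ {n} i (g : SetFn R (suc n)) L → Δ i g L ≡ ∂ R i g (removeAt L i)
  Δ≡∂-removeAt i g L = cong₂ (λ L₁ L₀ → g L₁ - g L₀) ([]≔-insertAt-removeAt L i true) ([]≔-insertAt-removeAt L i false)

  Δ-comm : ∀ {n} i j (g : SetFn R n) L → Δ j (Δ i g) L ≡ Δ i (Δ j g) L
  Δ-comm i j g L with i ≟ j
  ... | yes refl = refl
  ... | no i≢j = begin
    (g (L [ j ]≔ true [ i ]≔ true) - g (L [ j ]≔ true [ i ]≔ false))
      - (g (L [ j ]≔ false [ i ]≔ true) - g (L [ j ]≔ false [ i ]≔ false))
      ≡⟨ solve 4 (λ a b c d → (a :- b) :- (c :- d) := (a :- c) :- (b :- d)) refl _ _ _ _ ⟩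
    (g (L [ j ]≔ true [ i ]≔ true) - g (L [ j ]≔ false [ i ]≔ true))
      - (g (L [ j ]≔ true [ i ]≔ false) - g (L [ j ]≔ false [ i ]≔ false))
      ≡⟨ cong₂ _-_ (cong₂ (λ A B → g A - g B) (swap true true) (swap false true))
                   (cong₂ (λ A B → g A - g B) (swap true false) (swap false false)) ⟩
    (g (L [ i ]≔ true [ j ]≔ true) - g (L [ i ]≔ true [ j ]≔ false))
      - (g (L [ i ]≔ false [ j ]≔ true) - g (L [ i ]≔ false [ j ]≔ false)) ∎
    where
    swap : ∀ a b → L [ j ]≔ a [ i ]≔ b ≡ L [ i ]≔ b [ j ]≔ a
    swap a b = []≔-commutes L j i (i≢j ∘ sym)

  Δ-affine : ∀ {n} i {g h : SetFn R n} {c d} → (∀ L → h L ≡ c * g L + d) → ∀ L → Δ i h L ≡ c * Δ i g L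
  Δ-affine i {g} {h} {c} {d} h≡ L = begin
    h (L [ i ]≔ true) - h (L [ i ]≔ false)                 ≡⟨ cong₂ _-_ (h≡ _) (h≡ _) ⟩
    (c * g (L [ i ]≔ true) + d) - (c * g (L [ i ]≔ false) + d) ≡⟨ solve 4 (λ c d x y → (c :* x :+ d) :- (c :* y :+ d) := c :* (x :- y)) refl c d _ _ ⟩
    c * Δ i g L                                            ∎

  ∂-affine⇒Δ-affine : ∀ {n} i {g f : SetFn R (suc n)} {c d} →
                      (∀ K → ∂ R i g K ≡ c * ∂ R i f K + d) → ∀ L → Δ i g L ≡ c * Δ i f L + d
  ∂-affine⇒Δ-affine i {g} {f} {c} {d} ∂g≡ L =
    trans (Δ≡∂-removeAt i g L) (trans (∂g≡ (removeAt L i)) (cong (λ x → c * x + d) (sym (Δ≡∂-removeAt i f L))))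

  Δ-remainder : ∀ {n} i {g f : SetFn R n} {c d} L → Δ i g L ≡ c * Δ i f L + d → Δ i (λ I → g I - c * f I) L ≡ d
  Δ-remainder i {g} {f} {c} {d} L Δg≡ = begin
    (g (L [ i ]≔ true) - c * f (L [ i ]≔ true)) - (g (L [ i ]≔ false) - c * f (L [ i ]≔ false))
      ≡⟨ solve 5 (λ a b x y c → (a :- c :* x) :- (b :- c :* y) := (a :- b) :- c :* (x :- y)) refl
           (g (L [ i ]≔ true)) (g (L [ i ]≔ false)) (f (L [ i ]≔ true)) (f (L [ i ]≔ false)) c ⟩
    Δ i g L - c * Δ i f L           ≡⟨ cong (λ x → x - c * Δ i f L) Δg≡ ⟩
    (c * Δ i f L + d) - c * Δ i f L ≡⟨ solve 2 (λ x d → (x :+ d) :- x := d) refl (c * Δ i f L) d ⟩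
    d                               ∎

  supermodular⇒∂-nondecreasing : ∀ {n} {g : SetFn R (suc n)} → Supermodular R g → ∀ i → Nondecreasing R (∂ R i g)
  supermodular⇒∂-nondecreasing {n} {g} g-super i I J J⊆I = +≤+⇒-≤- (subst₂ (λ A B → g J₁ + g I₀ ≤ℝ g A + g B)
      (trans (zipWith-insertAt _∧_ J I i true false) (cong (λ K → insertAt K i false) (p⊆q⇒p∩q≡p J⊆I)))
      (trans (zipWith-insertAt _∨_ J I i true false) (cong (λ K → insertAt K i true) (p⊆q⇒p∪q≡q J⊆I)))
      (g-super J₁ I₀))
    where
    J₁ I₀ : Subset (suc n)
    J₁ = insertAt J i true
    I₀ = insertAt I i false

  ∂-+ : ∀ {n} {g g₁ g₂ : SetFn R (suc n)} → (∀ I → g I ≡ g₁ I + g₂ I) → ∀ i K → ∂ R i g K ≡ ∂ R i g₁ K + ∂ R i g₂ K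
  ∂-+ {g₁ = g₁} {g₂} g≡ i K = trans (cong₂ _-_ (g≡ _) (g≡ _))
    (solve 4 (λ a b c d → (a :+ b) :- (c :+ d) := (a :- c) :+ (b :- d)) refl
      (g₁ (insertAt K i true)) (g₂ (insertAt K i true)) (g₁ (insertAt K i false)) (g₂ (insertAt K i false)))

  modular⇒Δ²≡0 : ∀ {n} {g : SetFn R n} → Modular R g → ∀ i j L → Δ j (Δ i g) L ≡ 0#
  modular⇒Δ²≡0 {n} {g} g-mod i j L = begin
    (g L₁₁ - g L₁₀) - (g L₀₁ - g L₀₀) ≡⟨ solve 4 (λ a b c d → (a :- b) :- (c :- d) := (d :+ a) :- (b :+ c)) refl _ _ _ _ ⟩
    (g L₀₀ + g L₁₁) - (g L₁₀ + g L₀₁) ≡⟨ cong (λ x → x - (g L₁₀ + g L₀₁)) (cong₂ (λ A B → g A + g B) L₁₀∩L₀₁ L₁₀∪L₀₁) ⟨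
    (g (L₁₀ ∩ L₀₁) + g (L₁₀ ∪ L₀₁)) - (g L₁₀ + g L₀₁) ≡⟨ x≈y⇒x∙y⁻¹≈ε (g-mod L₁₀ L₀₁) ⟩
    0#                                ∎
    where
    L₁₁ L₁₀ L₀₁ L₀₀ : Subset n
    L₁₁ = L [ j ]≔ true [ i ]≔ true
    L₁₀ = L [ j ]≔ true [ i ]≔ false
    L₀₁ = L [ j ]≔ false [ i ]≔ true
    L₀₀ = L [ j ]≔ false [ i ]≔ false
    L₁₀∩L₀₁ : L₁₀ ∩ L₀₁ ≡ L₀₀
    L₁₀∩L₀₁ = trans (zipWith-[]≔ _∧_ (L [ j ]≔ true) (L [ j ]≔ false) i false true)
                    (cong (_[ i ]≔ false) (trans (zipWith-[]≔ _∧_ L L j true false) (cong (_[ j ]≔ false) (∩-idem L))))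
    L₁₀∪L₀₁ : L₁₀ ∪ L₀₁ ≡ L₁₁
    L₁₀∪L₀₁ = trans (zipWith-[]≔ _∨_ (L [ j ]≔ true) (L [ j ]≔ false) i false true)
                    (cong (_[ i ]≔ true) (trans (zipWith-[]≔ _∨_ L L j true false) (cong (_[ j ]≔ true) (∪-idem L))))

  Δ-constant⇒modular : ∀ {n} {h : SetFn R n} (a : Fin n → Carrier) → (∀ i L → Δ i h L ≡ a i) → Modular R h
  Δ-constant⇒modular {zero} a Δh≡a [] [] = refl
  Δ-constant⇒modular {suc n} {h} a Δh≡a (x ∷ I) (y ∷ J) = begin
    h ((x ∧ y) ∷ (I ∩ J)) + h ((x ∨ y) ∷ (I ∪ J))             ≡⟨ cong₂ _+_ (split (x ∧ y) (I ∩ J)) (split (x ∨ y) (I ∪ J)) ⟩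
    (h₀ (I ∩ J) + jump (x ∧ y)) + (h₀ (I ∪ J) + jump (x ∨ y)) ≡⟨ interchange _ _ _ _ ⟩
    (h₀ (I ∩ J) + h₀ (I ∪ J)) + (jump (x ∧ y) + jump (x ∨ y)) ≡⟨ cong₂ _+_ h₀-modular (jump-modular x y) ⟩
    (h₀ I + h₀ J) + (jump x + jump y)                         ≡⟨ interchange _ _ _ _ ⟩
    (h₀ I + jump x) + (h₀ J + jump y)                         ≡⟨ cong₂ _+_ (split x I) (split y J) ⟨
    h (x ∷ I) + h (y ∷ J)                                     ∎
    where
    h₀ : SetFn R n
    h₀ L = h (false ∷ L)
    h₀-modular : h₀ (I ∩ J) + h₀ (I ∪ J) ≡ h₀ I + h₀ J
    h₀-modular = Δ-constant⇒modular (a ∘ fsuc) (λ i L → Δh≡a (fsuc i) (false ∷ L)) I J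
    jump : Bool → Carrier
    jump true = a fzero
    jump false = 0#
    split : ∀ b L → h (b ∷ L) ≡ h₀ L + jump b
    split true L = x-y≡z⇒x≡y+z (Δh≡a fzero (false ∷ L))
    split false L = sym (+-identityʳ _)
    jump-modular : ∀ x y → jump (x ∧ y) + jump (x ∨ y) ≡ jump x + jump y
    jump-modular true true = refl
    jump-modular true false = +-comm _ _
    jump-modular false true = refl
    jump-modular false false = refl

  -- Separation

  Independent : ∀ {n} → SetFn R n → Fin n → Set
  Independent φ j = ∀ L → Δ j φ L ≡ 0#

  independent⇒agree-≡ : ∀ {n} (P : Fin n → Set) {φ : SetFn R n} → (∀ {j} → P j → Independent φ j) →
                        ∀ L L′ → (∀ k → P k ⊎ lookup L k ≡ lookup L′ k) → φ L ≡ φ L′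
  independent⇒agree-≡ P indep [] [] agree = refl
  independent⇒agree-≡ P {φ} indep (x ∷ L) (x′ ∷ L′) agree =
    trans head (independent⇒agree-≡ (P ∘ fsuc) (λ Pj → indep Pj ∘ (x′ ∷_)) L L′ (agree ∘ fsuc))
    where
    head-free : P fzero → ∀ b b′ → φ (b ∷ L) ≡ φ (b′ ∷ L)
    head-free P0 true true = refl
    head-free P0 true false = x-y≡0⇒x≡y (indep P0 (false ∷ L))
    head-free P0 false true = sym (x-y≡0⇒x≡y (indep P0 (false ∷ L)))
    head-free P0 false false = refl
    head : φ (x ∷ L) ≡ φ (x′ ∷ L)
    head with agree fzero
    ... | inj₁ P0 = head-free P0 x x′
    ... | inj₂ x≡x′ = cong (λ b → φ (b ∷ L)) x≡x′

  Separates : ∀ {n} → SetFn R n → Subset n → Set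
  Separates f S = ∀ {i j} → i ∈ S → j ∉ S → Independent (Δ i f) j

  separates-∁ : ∀ {n} {f : SetFn R n} {S} → Separates f S → Separates f (∁ S)
  separates-∁ {f = f} sep {i} {j} i∈∁S j∉∁S L = trans (Δ-comm i j f L) (sep (x∉∁p⇒x∈p j∉∁S) (x∈∁p⇒x∉p i∈∁S) L)

  Δ-local : ∀ {n} {f : SetFn R n} {S i} → Separates f S → i ∈ S → ∀ L → Δ i f (S ∩ L) ≡ Δ i f L
  Δ-local {S = S} sep i∈S L = independent⇒agree-≡ (_∉ S) (sep i∈S) (S ∩ L) L (∩-agrees S L)

  -- ψ I = f I - f (∁ S ∩ I) does not depend on the coordinates outside S, so ψ I = ψ (S ∩ I).
  separated-decomposition : ∀ {n} {f : SetFn R n} {S} → Separates f S → ∀ I → f I ≡ f (S ∩ I) + (f (∁ S ∩ I) - f ⊥)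
  separated-decomposition {n} {f} {S} sep I = a-b≡c-d⇒a≡c+[b-d] (begin
    ψ I                           ≡⟨ independent⇒agree-≡ (_∉ S) ψ-independent I (S ∩ I) (λ k → Sum.map₂ sym (∩-agrees S I k)) ⟩
    ψ (S ∩ I)                     ≡⟨ cong (λ A → f (S ∩ I) - f A) ∁S∩S∩I≡⊥ ⟩
    f (S ∩ I) - f ⊥               ∎)
    where
    ψ : SetFn R n
    ψ L = f L - f (∁ S ∩ L)
    ∁S∩S∩I≡⊥ : ∁ S ∩ (S ∩ I) ≡ ⊥
    ∁S∩S∩I≡⊥ = trans (sym (∩-assoc (∁ S) S I)) (trans (cong (_∩ I) (∩-inverseˡ S)) (∩-zeroˡ I))
    ψ-independent : ∀ {j} → j ∉ S → Independent ψ j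
    ψ-independent {j} j∉S L = begin
      (f (L [ j ]≔ true) - f (∁ S ∩ (L [ j ]≔ true))) - (f (L [ j ]≔ false) - f (∁ S ∩ (L [ j ]≔ false)))
        ≡⟨ cong₂ (λ A B → (f (L [ j ]≔ true) - f A) - (f (L [ j ]≔ false) - f B)) (∩-[]≔ j∈∁S L true) (∩-[]≔ j∈∁S L false) ⟩
      (f (L [ j ]≔ true) - f ((∁ S ∩ L) [ j ]≔ true)) - (f (L [ j ]≔ false) - f ((∁ S ∩ L) [ j ]≔ false))
        ≡⟨ solve 4 (λ a b c d → (a :- b) :- (c :- d) := (a :- c) :- (b :- d)) refl _ _ _ _ ⟩
      Δ j f L - Δ j f (∁ S ∩ L)   ≡⟨ cong (λ x → Δ j f L - x) (Δ-local {f = f} (separates-∁ {f = f} sep) j∈∁S L) ⟩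
      Δ j f L - Δ j f L           ≡⟨ x-x≡0 (Δ j f L) ⟩
      0#                          ∎
      where
      j∈∁S : j ∈ ∁ S
      j∈∁S = x∉p⇒x∈∁p j∉S

  supermodular-+-constant : ∀ {m} {g : SetFn R m} z → Supermodular R g → Supermodular R (λ I → g I + z)
  supermodular-+-constant {g = g} z g-super I J = subst₂ _≤ℝ_
    (interchange (g I) (g J) z z) (interchange (g (I ∩ J)) (g (I ∪ J)) z z) (+-mono-≤ (z + z) (g-super I J))

  IrreducibleOrConstant : ∀ {n} → SetFn R n → Set
  IrreducibleOrConstant g = IrreducibleNondecreasing R g ⊎ Constant R g

  irreducible-or-constant-retract : ∀ {m n} {G : SetFn R m} {H : SetFn R n}
    (π : Subset m → Subset n) (σ : Subset n → Subset m) → (∀ {K K′} → K ⊆ K′ → π K ⊆ π K′) →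
    (∀ J → π (σ J) ≡ J) → (∀ K → G K ≡ H (π K)) → IrreducibleOrConstant G → IrreducibleOrConstant H
  irreducible-or-constant-retract {G = G} {H} π σ π-mono πσ≡id G≡H∘π G-irr-or-const = case G-irr-or-const
    where
    H≡G∘σ : ∀ J → H J ≡ G (σ J)
    H≡G∘σ J = trans (cong H (sym (πσ≡id J))) (sym (G≡H∘π (σ J)))
    pullback : ∀ {h} → ConstMultiple R (h ∘ π) G → ConstMultiple R h H
    pullback {h} (c , 0≤c , d , h∘π≡) =
      c , 0≤c , d , λ J → trans (cong h (sym (πσ≡id J))) (trans (h∘π≡ (σ J)) (cong (λ x → c * x + d) (sym (H≡G∘σ J))))
    case : IrreducibleOrConstant G → IrreducibleOrConstant H
    case (inj₂ G-const) = inj₂ (λ I J → trans (H≡G∘σ I) (trans (G-const (σ I) (σ J)) (sym (H≡G∘σ J))))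
    case (inj₁ (G-nonconst , G-split)) = inj₁ (H-nonconst , H-split)
      where
      H-nonconst : ¬ Constant R H
      H-nonconst H-const = G-nonconst (λ I J → trans (G≡H∘π I) (trans (H-const (π I) (π J)) (sym (G≡H∘π J))))
      H-split : ∀ h₁ h₂ → Nondecreasing R h₁ → Nondecreasing R h₂ → (∀ I → H I ≡ h₁ I + h₂ I) →
                ConstMultiple R h₁ H × ConstMultiple R h₂ H
      H-split h₁ h₂ h₁↑ h₂↑ H≡h₁+h₂ = Product.map pullback pullback
        (G-split (h₁ ∘ π) (h₂ ∘ π) (λ I J J⊆I → h₁↑ (π I) (π J) (π-mono J⊆I)) (λ I J J⊆I → h₂↑ (π I) (π J) (π-mono J⊆I))
                 (λ K → trans (G≡H∘π K) (H≡h₁+h₂ (π K))))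

  simple-+-constant : ∀ {m} {g : SetFn R m} z → Simple R g → Simple R (λ I → g I + z)
  simple-+-constant {zero} z g-super = supermodular-+-constant z g-super
  simple-+-constant {suc m} {g} z (g-super , g-∂) = supermodular-+-constant z g-super ,
    λ i → irreducible-or-constant-retract id id id (λ _ → refl) (λ K → sym (∂-+-constant i K)) (g-∂ i)
    where
    ∂-+-constant : ∀ i K → ∂ R i (λ I → g I + z) K ≡ ∂ R i g K
    ∂-+-constant i K = solve 3 (λ x y z → (x :+ z) :- (y :+ z) := x :- y) refl _ _ z

  supermodular-∘extend : ∀ {n m} {S : Subset n} (C : Coordinates S m) {f : SetFn R n} →
                         Supermodular R f → Supermodular R (f ∘ Coordinates.extend C)
  supermodular-∘extend C {f} f-super I J = subst (λ A → f (extend I) + f (extend J) ≤ℝ A)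
    (cong₂ (λ A B → f A + f B) (sym (extend-∩ I J)) (sym (extend-∪ I J))) (f-super (extend I) (extend J))
    where open Coordinates C

  ∂-∘extend : ∀ {n m} {S : Subset n} (C : Coordinates S (suc m)) (f : SetFn R n) a J →
              ∂ R a (f ∘ Coordinates.extend C) J ≡ Δ (Coordinates.embedding C a) f (Coordinates.extend C (insertAt J a false))
  ∂-∘extend C f a J = cong₂ (λ A B → f A - f B) (extend-insertAt true) (extend-insertAt false)
    where
    open Coordinates C
    extend-insertAt : ∀ b → extend (insertAt J a b) ≡ extend (insertAt J a false) [ embedding a ]≔ b
    extend-insertAt b = trans (cong extend (sym (insertAt-[]≔ J a false b))) (extend-[]≔ (insertAt J a false) a b)

  simple-∘extend : ∀ {n m} {f : SetFn R (suc n)} {S} → Simple R f → Separates f S →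
                   (C : Coordinates S m) → Simple R (f ∘ Coordinates.extend C)
  simple-∘extend {m = zero} (f-super , _) sep C = supermodular-∘extend C f-super
  simple-∘extend {n} {suc m} {f} {S} (f-super , f-∂) sep C = supermodular-∘extend C f-super ,
    λ a → irreducible-or-constant-retract (π a) (σ a) (π-mono a) (πσ≡id a) (∂f≡ a) (f-∂ (embedding a))
    where
    open Coordinates C
    π : Fin (suc m) → Subset n → Subset m
    π a K = removeAt (restrict embedding (insertAt K (embedding a) false)) a
    σ : Fin (suc m) → Subset m → Subset n
    σ a J = removeAt (extend (insertAt J a false)) (embedding a)
    π-mono : ∀ a {K K′} → K ⊆ K′ → π a K ⊆ π a K′
    π-mono a = removeAt-mono a ∘ restrict-mono embedding ∘ insertAt-mono (embedding a) false
    πσ≡id : ∀ a J → π a (σ a J) ≡ J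
    πσ≡id a J = begin
      removeAt (restrict embedding (insertAt (removeAt X i) i false)) a ≡⟨ cong (λ Y → removeAt (restrict embedding Y) a) X-restored ⟩
      removeAt (restrict embedding X) a                                 ≡⟨ cong (λ Y → removeAt Y a) (restrict-extend (insertAt J a false)) ⟩
      removeAt (insertAt J a false) a                                   ≡⟨ removeAt-insertAt J a false ⟩
      J                                                                 ∎
      where
      i : Fin (suc n)
      i = embedding a
      X : Subset (suc n)
      X = extend (insertAt J a false)
      X-restored : insertAt (removeAt X i) i false ≡ X
      X-restored = begin
        insertAt (removeAt X i) i false          ≡⟨ []≔-insertAt-removeAt X i false ⟨
        X [ i ]≔ false                           ≡⟨ extend-[]≔ (insertAt J a false) a false ⟨
        extend (insertAt J a false [ a ]≔ false) ≡⟨ cong extend (insertAt-[]≔ J a false false) ⟩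
        X                                        ∎
    ∂f≡ : ∀ a K → ∂ R (embedding a) f K ≡ ∂ R a (f ∘ extend) (π a K)
    ∂f≡ a K = begin
      ∂ R i f K                                  ≡⟨ ∂≡Δ-insertAt i f K false ⟩
      Δ i f L                                    ≡⟨ Δ-local {f = f} sep (embedding-∈ a) L ⟨
      Δ i f (S ∩ L)                              ≡⟨ cong (Δ i f) (extend-restrict L) ⟨
      Δ i f (extend Y)                           ≡⟨ Δ-[]≔ i f (extend Y) false ⟨
      Δ i f (extend Y [ i ]≔ false)              ≡⟨ cong (Δ i f) (extend-[]≔ Y a false) ⟨
      Δ i f (extend (Y [ a ]≔ false))            ≡⟨ cong (Δ i f ∘ extend) ([]≔-insertAt-removeAt Y a false) ⟩
      Δ i f (extend (insertAt (π a K) a false))  ≡⟨ ∂-∘extend C f a (π a K) ⟨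
      ∂ R a (f ∘ extend) (π a K)                 ∎
      where
      i : Fin (suc n)
      i = embedding a
      L : Subset (suc n)
      L = insertAt K i false
      Y : Subset (suc m)
      Y = restrict embedding L

  -- The interaction graph

  Interact : ∀ {n} → SetFn R n → Fin n → Fin n → Set
  Interact f i j = ∃ λ L → Δ j (Δ i f) L ≢ 0#

  constant-∂⇒Δ²≡0 : ∀ {n} {f : SetFn R (suc n)} {i} → Constant R (∂ R i f) → ∀ j L → Δ j (Δ i f) L ≡ 0#
  constant-∂⇒Δ²≡0 {f = f} {i} ∂f-const j L = x≈y⇒x∙y⁻¹≈ε (begin
    Δ i f (L [ j ]≔ true)                 ≡⟨ Δ≡∂-removeAt i f _ ⟩
    ∂ R i f (removeAt (L [ j ]≔ true) i)  ≡⟨ ∂f-const _ _ ⟩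
    ∂ R i f (removeAt (L [ j ]≔ false) i) ≡⟨ Δ≡∂-removeAt i f _ ⟨
    Δ i f (L [ j ]≔ false)                ∎)

  Δ-≡-dec : ∀ {n} {f : SetFn R (suc n)} → Supermodular R f → ∀ i → IrreducibleOrConstant (∂ R i f) →
            ∀ L L′ → Dec (Δ i f L ≡ Δ i f L′)
  Δ-≡-dec {f = f} f-super i ∂f L L′ with ∂f
  ... | inj₂ ∂f-const = yes (trans (Δ≡∂-removeAt i f L) (trans (∂f-const _ _) (sym (Δ≡∂-removeAt i f L′))))
  ... | inj₁ ∂f-irr = map′ (λ eq → trans (Δ≡∂-removeAt i f L) (trans eq (sym (Δ≡∂-removeAt i f L′))))
                           (λ eq → trans (sym (Δ≡∂-removeAt i f L)) (trans eq (Δ≡∂-removeAt i f L′)))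
                           (irreducible⇒≡-dec (supermodular⇒∂-nondecreasing f-super i) ∂f-irr (removeAt L i) (removeAt L′ i))

  Δ²≡0-dec : ∀ {n} {f : SetFn R (suc n)} → Simple R f → ∀ i j L → Dec (Δ j (Δ i f) L ≡ 0#)
  Δ²≡0-dec (f-super , f-∂) i j L =
    map′ x≈y⇒x∙y⁻¹≈ε x-y≡0⇒x≡y (Δ-≡-dec f-super i (f-∂ i) (L [ j ]≔ true) (L [ j ]≔ false))

  interact? : ∀ {n} {f : SetFn R (suc n)} → Simple R f → ∀ i j → Dec (Interact f i j)
  interact? f-simple i j = anySubset? (λ L → ¬? (Δ²≡0-dec f-simple i j L))

  closed⇒separates : ∀ {n} {f : SetFn R (suc n)} {T} → Simple R f → Closed (Interact f) T → Separates f T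
  closed⇒separates f-simple T-closed {i} {j} i∈T j∉T L =
    decidable-stable (Δ²≡0-dec f-simple i j L) (λ Δ²≢0 → j∉T (T-closed i∈T (L , Δ²≢0)))

  interact⇒same-scale : ∀ {n} {f g : SetFn R n} {i j c c′ d d′} → Interact f i j →
                        (∀ L → Δ i g L ≡ c * Δ i f L + d) → (∀ L → Δ j g L ≡ c′ * Δ j f L + d′) → c ≡ c′
  interact⇒same-scale {f = f} {g} {i} {j} {c} {c′} (L , x≢0) Δig≡ Δjg≡ =
    x-y≡0⇒x≡y (nonzero-*-cancel x (c - c′) x≢0 (begin
      x * (c - c′)                 ≡⟨ solve 3 (λ x c c′ → x :* (c :- c′) := c :* x :- c′ :* x) refl x c c′ ⟩
      c * x - c′ * x               ≡⟨ cong (λ y → y - c′ * x) cx≡c′x ⟩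
      c′ * x - c′ * x              ≡⟨ x-x≡0 (c′ * x) ⟩
      0#                           ∎))
    where
    x : Carrier
    x = Δ j (Δ i f) L
    cx≡c′x : c * x ≡ c′ * x
    cx≡c′x = begin
      c * Δ j (Δ i f) L   ≡⟨ Δ-affine j Δig≡ L ⟨
      Δ j (Δ i g) L       ≡⟨ Δ-comm i j g L ⟩
      Δ i (Δ j g) L       ≡⟨ Δ-affine i Δjg≡ L ⟩
      c′ * Δ i (Δ j f) L  ≡⟨ cong (c′ *_) (Δ-comm i j f L) ⟨
      c′ * Δ j (Δ i f) L  ∎

  Connected : ∀ {n} → SetFn R (suc n) → Set
  Connected f = ∀ i → Reachable (Interact f) ⁅ fzero ⁆ i

  module _ {n} {f : SetFn R (suc (suc n))} (f-simple : Simple R f) (connected : Connected f) where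

    f-∂ : ∀ i → IrreducibleOrConstant (∂ R i f)
    f-∂ = proj₂ f-simple

    fzero-interacts : ¬ (∀ j L → Δ j (Δ fzero f) L ≡ 0#)
    fzero-interacts Δ²≡0 = contradiction (reachable-from-isolated (λ j (L , Δ²≢0) → Δ²≢0 (Δ²≡0 j L)) (connected (fsuc fzero))) λ ()

    ∂fzero-irreducible : IrreducibleNondecreasing R (∂ R fzero f)
    ∂fzero-irreducible with f-∂ fzero
    ... | inj₁ ∂f-irr = ∂f-irr
    ... | inj₂ ∂f-const = contradiction (constant-∂⇒Δ²≡0 {f = f} ∂f-const) fzero-interacts

    connected⇒modular-multiple : ∀ {g₁ g₂} → Supermodular R g₁ → Supermodular R g₂ → (∀ I → f I ≡ g₁ I + g₂ I) →
                                 ModularMultiple R g₁ f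
    connected⇒modular-multiple {g₁} {g₂} g₁-super g₂-super f≡g₁+g₂ = scale (split fzero ∂fzero-irreducible)
      where
      split : ∀ j → IrreducibleNondecreasing R (∂ R j f) → ConstMultiple R (∂ R j g₁) (∂ R j f)
      split j (_ , ∂f-split) = proj₁ (∂f-split (∂ R j g₁) (∂ R j g₂)
        (supermodular⇒∂-nondecreasing g₁-super j) (supermodular⇒∂-nondecreasing g₂-super j) (∂-+ f≡g₁+g₂ j))
      scale : ConstMultiple R (∂ R fzero g₁) (∂ R fzero f) → ModularMultiple R g₁ f
      scale (c , 0≤c , d₀ , ∂₀-scaled) = c , 0≤c , Δ-constant⇒modular (proj₁ ∘ scaled ∘ connected) residual-constant
        where
        Scaled : Fin (suc (suc n)) → Set
        Scaled j = ∃ λ d → ∀ L → Δ j g₁ L ≡ c * Δ j f L + d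
        scaled : ∀ {j} → Reachable (Interact f) ⁅ fzero ⁆ j → Scaled j
        scaled (source j∈⁅0⁆) = subst Scaled (sym (x∈⁅y⁆⇒x≡y fzero j∈⁅0⁆)) (d₀ , ∂-affine⇒Δ-affine fzero {g₁} {f} ∂₀-scaled)
        scaled {j} (step {i} reach-i interact) = propagate (scaled reach-i) (f-∂ j)
          where
          propagate : Scaled i → IrreducibleOrConstant (∂ R j f) → Scaled j
          propagate _ (inj₂ ∂f-const) =
            contradiction (trans (Δ-comm i j f (proj₁ interact)) (constant-∂⇒Δ²≡0 {f = f} ∂f-const i _)) (proj₂ interact)
          propagate (d , Δig₁≡) (inj₁ ∂f-irr) = adopt (split j ∂f-irr)
            where
            adopt : ConstMultiple R (∂ R j g₁) (∂ R j f) → Scaled j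
            adopt (c′ , _ , d′ , ∂-scaled′) = d′ , λ L → trans (∂-affine⇒Δ-affine j {g₁} {f} ∂-scaled′ L) (cong (λ k → k * Δ j f L + d′) (sym c≡c′))
              where
              c≡c′ : c ≡ c′
              c≡c′ = interact⇒same-scale {f = f} {g₁} interact Δig₁≡ (∂-affine⇒Δ-affine j {g₁} {f} ∂-scaled′)
        residual-constant : ∀ i L → Δ i (λ I → g₁ I - c * f I) L ≡ proj₁ (scaled (connected i))
        residual-constant i L = Δ-remainder i {g₁} {f} L (proj₂ (scaled (connected i)) L)

    connected⇒irreducible : IrreducibleSupermodular R f
    connected⇒irreducible = f-not-modular , λ g₁ g₂ g₁-super g₂-super f≡g₁+g₂ →
      connected⇒modular-multiple g₁-super g₂-super f≡g₁+g₂ ,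
      connected⇒modular-multiple g₂-super g₁-super (λ I → trans (f≡g₁+g₂ I) (+-comm (g₁ I) (g₂ I)))
      where
      f-not-modular : ¬ Modular R f
      f-not-modular f-mod = fzero-interacts (λ j → modular⇒Δ²≡0 f-mod fzero j)

lemma6p2 : (R : Reals) (n : ℕ) → 2 ≤ n → (f : Subset n → Reals.Carrier R) →
    Simple R f → ¬ IrreducibleSupermodular R f →
    Σ ℕ λ m₁ → Σ ℕ λ m₂ → 1 ≤ m₁ × 1 ≤ m₂ ×
    Σ (Fin m₁ → Fin n) λ e₁ → Σ (Fin m₂ → Fin n) λ e₂ →
      Injective _≡_ _≡_ e₁ × Injective _≡_ _≡_ e₂ ×
      (∀ a b → e₁ a ≢ e₂ b) ×
      (∀ k → (∃ λ a → e₁ a ≡ k) ⊎ (∃ λ b → e₂ b ≡ k)) ×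
      Σ (Subset m₁ → Reals.Carrier R) λ g₁ → Σ (Subset m₂ → Reals.Carrier R) λ g₂ →
        Simple R g₁ × Simple R g₂ ×
        (∀ I → f I ≡ Reals._+_ R (g₁ (restrict e₁ I)) (g₂ (restrict e₂ I)))
lemma6p2 R (suc (suc m)) (s≤s (s≤s z≤n)) f f-simple f-reducible
  with reachable-or-cut (interact? R f-simple) ⁅ fzero ⁆
... | inj₁ connected = contradiction (connected⇒irreducible R f-simple connected) f-reducible
... | inj₂ (S , ⁅0⁆⊆S , (j , j∉S) , S-closed) =
  ∣ S ∣ , ∣ ∁ S ∣ , index⇒1≤ (proj₁ (∈⇒embed (⁅0⁆⊆S (x∈⁅x⁆ fzero)))) , index⇒1≤ (proj₁ (∈⇒embed (x∉p⇒x∈∁p j∉S))) ,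
  embed S , embed (∁ S) , embed-injective S , embed-injective (∁ S) , embed-disjoint S , embed-cover S ,
  f ∘ widen S , (λ K → f (widen (∁ S) K) - f ⊥) ,
  simple-∘extend R f-simple separated (coordinates S) ,
  simple-+-constant R (- f ⊥) (simple-∘extend R f-simple (separates-∁ R {f = f} separated) (coordinates (∁ S))) ,
  λ I → trans (separated-decomposition R separated I)
              (sym (cong₂ (λ A B → f A + (f B - f ⊥)) (widen-restrict S I) (widen-restrict (∁ S) I)))
  where
  open Reals R using (_+_; _-_; -_)
  separated : Separates R f S
  separated = closed⇒separates R f-simple S-closed
  index⇒1≤ : ∀ {p} → Fin p → 1 ≤ p
  index⇒1≤ {suc p} _ = s≤s z≤n
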